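{- Let $d,k\ge2$ be integers, $\theta\in(0,1)$, $D\in\mathbb{N}$, $F$ a $(d,k)$-CSP formula whose unique satisfying assignment is $\alpha^*\equiv d$, $x$ a non-privileged variable of $F$, $c'\in\{1,\dots,d-1\}$, and $p:=\pi(x)$. If the event $\mathrm{ImpCut}_p(T^h_{x,c'})$ happens, then $A^{\mathrm{imp}}_{x,c'}=0$.
   Context: A $(d,k)$-CSP formula over $V$ and colors $[d]$ is a conjunction of clauses, each a disjunction of $k$ literals $(y\neq a)$, $y\in V$, $a\in[d]$; an assignment $\alpha:V\to[d]$ satisfies $(y\ne a)$ iff $\alpha(y)\ne a$, a clause iff one literal is satisfied, the formula iff all clauses are. For a partial assignment $\alpha$ (domain $\mathrm{vbl}(\alpha)\subseteq V$), $F^{[\alpha]}$ is obtained by fixing those variables (satisfied clauses removed, falsified literals deleted); $[U\mapsto d]$ sets all variables of $U$ to $d$. A formula $G$ $D$-implies a literal $u$ if some set of at most $D$ clauses of $G$ is such that all assignments satisfying them satisfy $u$; $\mathrm{Plaus}(y,G)$ is the set of colors $a$ such that $G$ does not $D$-imply $(y\ne a)$. Let $L=(d-1)(k-1)$, $\tilde h$ the largest integer with $1+L+\dots+L^{\tilde h}\le D$, $h:=2\tilde h+1$. Randomness: $\pi:V\to[0,1]$ (injective); $c=2-\log_2 3$; each $\mathbb{I}_y\in\{0,1\}$ with $\mathbb{I}_y=0$ whenever $\pi(y)\ge\theta$ (if $\pi(y)<\theta$, $\mathbb{I}_y=1$ with probability $c$ independently). ImpatientPPSZ$(F,\pi)$: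 start with empty $\alpha$; for each $z$ in increasing order of $\pi$: (a) while some $y\notin\mathrm{vbl}(\alpha)$ has $\mathbb{I}_y=1$ and $|\mathrm{Plaus}(y,F^{[\alpha]})|\le2$, assign $y$ a random color from $\mathrm{Plaus}(y,F^{[\alpha]})$; (b) if $z\notin\mathrm{vbl}(\alpha)$, assign $z$ a random color from $\mathrm{Plaus}(z,F^{[\alpha]})$. $V^{\mathrm{imp}}_x$: run this with every color choice replaced by $d$, stop in the iteration processing $x$ just after (a), and set $V^{\mathrm{imp}}_x:=\mathrm{vbl}(\alpha)\setminus\{x\}$. $A^{\mathrm{imp}}_{x,c'}:=1$ if $c'\in\mathrm{Plaus}(x,F^{[V^{\mathrm{imp}}_x\mapsto d]})$, else $0$. Critical clause trees: for $x\in V$, $c'\in[d-1]$, a tree $T^h_{x,c'}$ is built and fixed once: even-depth nodes are clause nodes $u$ with an assignment $\beta_u:V\to[d]$, odd-depth nodes are variable nodes with a label $\mathrm{varlabel}\in V$. The root has $\beta=\alpha^*$ changed at $x$ to $c'$. Each clause node $u$ of depth $\le h-1$ gets as label a clause $C$ of $F$ not satisfied by $\beta_u$; for each literal $(y\ne d)$ in $C$, $u$ gets a variable child $v$ labeled $y$, and $v$ gets children clause nodes $w$, one per $i\in[d-1]$, with $\beta_w=\beta_u$ changed at $y$ to $i$. Clause nodes at depth $h+1$ are discarded. Safe leaves are the variable nodes at depth $h$. $x$ is privileged if for some $c'\in[d-1]$, $T^h_{x,c'}$ has fewer than $(k-1)^2(d-1)$ variable nodes at depth 3, or the part of $T^h_{x,c'}$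 at depth $\le3$ has two distinct variable nodes with the same label; otherwise non-privileged. Events: for a subtree $T$ (rooted at some node, consisting of it and its descendants), $\mathrm{Cut}_p(T)$ is the event that every path from the root of $T$ to a safe leaf contains a variable node $v$ with $\pi(\mathrm{varlabel}(v))<p$. For nodes $v$ of $T^h_{x,c'}$ at depth 1, 2, 3 define $\mathrm{LocalImpCut}_p(v)$: at depth 3, it happens iff $\pi(\mathrm{varlabel}(v))<p$; at depth 2, iff $\mathrm{LocalImpCut}_p(w)$ happens for all children $w$ of $v$; at depth 1, with $y=\mathrm{varlabel}(v)$, iff $\pi(y)<p$, or ($\mathbb{I}_y=1$ and $\mathrm{LocalImpCut}_p(w)$ happens for at least $d-2$ of the $d-1$ children $w$ of $v$). Let $v_1,\dots,v_m$ be the children of the root of $T^h_{x,c'}$ and $T_i$ the subtree rooted at $v_i$. Then $\mathrm{ImpCut}_p(T^h_{x,c'}):=\bigwedge_{i=1}^m\left(\mathrm{Cut}_p(T_i)\vee\mathrm{LocalImpCut}_p(v_i)\right)$.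
   Formalization: The map π takes rational values in [0,1], and the threshold θ is a rational number in (0,1). -}

module Defs where

open import Data.Nat as ℕ using (ℕ; zero; suc; _+_; _*_; _∸_; _^_; _≤_; _<_)
open import Data.Fin as Fin using (Fin; inject₁; fromℕ)
open import Data.Fin.Subset as Sub using (Subset; _∈_; _∉_; _∪_; ⁅_⁆; _-_)
open import Data.Bool using (Bool; true; false; if_then_else_; _∧_)
open import Data.Maybe using (Maybe; just; nothing)
import Data.Maybe as Maybe
open import Data.List as List using (List; []; _∷_; length; mapMaybe; concatMap; allFin; map; tabulate; _++_)
open import Data.List.Relation.Unary.All using (All)
open import Data.List.Relation.Unary.Any using (Any)
open import Data.List.Relation.Unary.Linked using (Linked)
open import Data.List.Relation.Unary.Unique.Propositional using (Unique)
import Data.List.Membership.Propositional as LMem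
open import Data.Product using (Σ; ∃; _×_; _,_; proj₁; proj₂)
open import Data.Sum using (_⊎_)
open import Data.Unit using (⊤)
open import Data.Empty using (⊥)
open import Relation.Nullary using (¬_; does)
open import Relation.Binary.PropositionalEquality using (_≡_)
open import Function using (_∘_)
open import Data.Rational as ℚ using (ℚ; 0ℚ; 1ℚ)
import Data.Rational.Properties as ℚP
import Data.Vec as Vec

-- Conventions.
--  * Variables: V = Fin n.
--  * Colours: [d] with d = suc e; colour i ∈ [d] is represented by the
--    element of Fin (suc e) with toℕ = i - 1.  Hence the colour d is
--    `top = fromℕ e`, and the colours [d-1] are `inject₁ i` for i : Fin e.

Color : ℕ → Set
Color e = Fin (suc e)

top : ∀ {e} → Color e
top {e} = fromℕ e

-- literal (y ≠ a)
Lit : ℕ → ℕ → Set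
Lit n e = Fin n × Color e

Clause : ℕ → ℕ → Set
Clause n e = List (Lit n e)

Formula : ℕ → ℕ → Set
Formula n e = List (Clause n e)

Assignment : ℕ → ℕ → Set
Assignment n e = Fin n → Color e

PartialAssignment : ℕ → ℕ → Set
PartialAssignment n e = Fin n → Maybe (Color e)

module _ {n e : ℕ} where

  IsCSP : ℕ → Formula n e → Set
  IsCSP k F = All (λ C → length C ≡ k) F

  SatLit : Assignment n e → Lit n e → Set
  SatLit β (y , a) = ¬ (β y ≡ a)

  SatClause : Assignment n e → Clause n e → Set
  SatClause β C = Any (SatLit β) C

  SatFormula : Assignment n e → Formula n e → Set
  SatFormula β F = All (SatClause β) F

  update : Assignment n e → Fin n → Color e → Assignment n e
  update β y c z = if does (z Fin.≟ y) then c else β z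

  restrictClause : PartialAssignment n e → Clause n e → Maybe (Clause n e)
  restrictClause α [] = just []
  restrictClause α ((y , a) ∷ C) with α y
  ... | nothing = Maybe.map ((y , a) ∷_) (restrictClause α C)
  ... | just b  = if does (b Fin.≟ a) then restrictClause α C else nothing

  restrict : PartialAssignment n e → Formula n e → Formula n e
  restrict α F = mapMaybe (restrictClause α) F

  fixTop : Subset n → PartialAssignment n e
  fixTop U y = if Vec.lookup U y then just top else nothing

  DImplies : ℕ → Formula n e → Lit n e → Set
  DImplies D G u =
    Σ (List (Clause n e)) λ S →
      (length S ≤ D) × All (LMem._∈ G) S ×
      (∀ (β : Assignment n e) → All (SatClause β) S → SatLit β u)

  Plaus : ℕ → Formula n e → Fin n → Color e → Set
  Plaus D G y a = ¬ DImplies D G (y , a)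

  PlausAtMostTwo : ℕ → Formula n e → Fin n → Set
  PlausAtMostTwo D G y =
    Σ (List (Color e)) λ L → (length L ≤ 2) × (∀ a → Plaus D G y a → a LMem.∈ L)

  -- ImpatientPPSZ with every colour choice replaced by d.
  -- The state is the set U of assigned variables (all assigned colour d),
  -- so the current partial assignment is fixTop U.
  module Impatient (D : ℕ) (F : Formula n e) (𝕀 : Fin n → Bool) where

    Eligible : Subset n → Fin n → Set
    Eligible U y = (y ∉ U) × (𝕀 y ≡ true) × PlausAtMostTwo D (restrict (fixTop U) F) y

    -- step (a): the while loop; Closure U W = some complete run of the
    -- loop started in state U ends in state W
    data Closure : Subset n → Subset n → Set where
      stop : ∀ {U} → (∀ y → ¬ Eligible U y) → Closure U U
      step : ∀ {U W} y → Eligible U y → Closure (U ∪ ⁅ y ⁆) W → Closure U W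

    -- processing the iterations of z₁, z₂, … (in the given order) fully:
    -- step (a), then step (b) (assign z if still unassigned)
    data Process : Subset n → List (Fin n) → Subset n → Set where
      done : ∀ {U} → Process U [] U
      iter : ∀ {U U′ W z zs} → Closure U U′ → Process (U′ ∪ ⁅ z ⁆) zs W →
             Process U (z ∷ zs) W

  PrefixBefore : (Fin n → ℚ) → Fin n → List (Fin n) → Set
  PrefixBefore π x zs =
    Linked (λ a b → π a ℚ.< π b) zs × (∀ z → (z LMem.∈ zs → π z ℚ.< π x) × (π z ℚ.< π x → z LMem.∈ zs))

  -- V : a possible value of V^imp_x (one for each admissible run; the
  -- order in which the while loop picks eligible variables is arbitrary)
  IsVimp : ℕ → Formula n e → (Fin n → ℚ) → (Fin n → Bool) → Fin n → Subset n → Set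
  IsVimp D F π 𝕀 x V =
    Σ (List (Fin n)) λ zs → Σ (Subset n) λ W → Σ (Subset n) λ W′ →
      PrefixBefore π x zs × Process Sub.⊥ zs W × Closure W W′ × (V ≡ W′ - x)
    where open Impatient D F 𝕀

  -- A^imp_{x,c'} = 0  ⟺  c' ∉ Plaus(x, F^{[V^imp_x ↦ d]})
  AimpZero : ℕ → Formula n e → Subset n → Fin n → Color e → Set
  AimpZero D F V x c = ¬ Plaus D (restrict (fixTop V) F) x c

-- CTree n e r : a clause node whose variable children have r further
-- levels of clause nodes below them.  The root of T^h_{x,c'} is a
-- CTree h̃ (h = 2h̃+1); a clause node of CTree r lies at depth 2(h̃ - r),
-- its variable children at depth 2(h̃ - r) + 1; the VTree zero nodes are
-- exactly the variable nodes at depth h, i.e. the safe leaves.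
-- The assignments β_u are not stored; they are determined by the path
-- and are threaded through the validity predicate.

mutual
  data CTree (n e : ℕ) : ℕ → Set where
    cnode : ∀ {r} → Clause n e → List (VTree n e r) → CTree n e r

  data VTree (n e : ℕ) : ℕ → Set where
    leaf  : Fin n → VTree n e zero
    vnode : ∀ {r} → Fin n → (Fin e → CTree n e r) → VTree n e (suc r)
    -- children of a variable node labelled y: one clause node per
    -- colour i ∈ [d-1], with β changed at y to i

module _ {n e : ℕ} where

  varlabel : ∀ {r} → VTree n e r → Fin n
  varlabel (leaf y) = y
  varlabel (vnode y _) = y

  topVars : Clause n e → List (Fin n)
  topVars [] = []
  topVars ((y , a) ∷ C) = if does (a Fin.≟ top) then y ∷ topVars C else topVars C

  mutual
    ValidC : Formula n e → ∀ {r} → Assignment n e → CTree n e r → Set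
    ValidC F β (cnode C vs) =
      (C LMem.∈ F) × ¬ SatClause β C × ValidKids F β (topVars C) vs

    ValidKids : Formula n e → ∀ {r} → Assignment n e → List (Fin n) → List (VTree n e r) → Set
    ValidKids F β [] [] = ⊤
    ValidKids F β [] (_ ∷ _) = ⊥
    ValidKids F β (_ ∷ _) [] = ⊥
    ValidKids F β (y ∷ ys) (v ∷ vs) = (varlabel v ≡ y) × ValidV F β v × ValidKids F β ys vs

    ValidV : Formula n e → ∀ {r} → Assignment n e → VTree n e r → Set
    ValidV F β (leaf y) = ⊤
    ValidV F β (vnode y ws) = ∀ (i : Fin e) → ValidC F (update β y (inject₁ i)) (ws i)

  IsCCTree : Formula n e → (h̃ : ℕ) → Fin n → Fin e → CTree n e h̃ → Set
  IsCCTree F h̃ x c′ T = ValidC F (update (λ _ → top) x (inject₁ c′)) T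

  kidsOf : ∀ {r} → CTree n e r → List (VTree n e r)
  kidsOf (cnode _ vs) = vs

  depth1Labels : ∀ {r} → CTree n e r → List (Fin n)
  depth1Labels T = map varlabel (kidsOf T)

  depth3Labels : ∀ {r} → CTree n e r → List (Fin n)
  depth3Labels T = concatMap grand (kidsOf T)
    where
      grand : ∀ {r} → VTree n e r → List (Fin n)
      grand (leaf _) = []
      grand (vnode _ ws) = concatMap (λ i → map varlabel (kidsOf (ws i))) (allFin e)

  NonPrivileged : (k : ℕ) → ∀ {h̃} → (Fin e → CTree n e h̃) → Set
  NonPrivileged k T = ∀ (c″ : Fin e) →
    ((k ∸ 1) * (k ∸ 1) * e ≤ length (depth3Labels (T c″))) ×
    Unique (depth1Labels (T c″) ++ depth3Labels (T c″))

  module Events (π : Fin n → ℚ) (𝕀 : Fin n → Bool) (p : ℚ) where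

    low : Fin n → Bool
    low y = does (π y ℚP.<? p)

    mutual
      CutV : ∀ {r} → VTree n e r → Set
      CutV (leaf y) = π y ℚ.< p
      CutV (vnode y ws) = (π y ℚ.< p) ⊎ (∀ i → CutC (ws i))

      CutC : ∀ {r} → CTree n e r → Set
      CutC (cnode _ vs) = CutAll vs

      CutAll : ∀ {r} → List (VTree n e r) → Set
      CutAll [] = ⊤
      CutAll (v ∷ vs) = CutV v × CutAll vs

    countTrue : List Bool → ℕ
    countTrue [] = 0
    countTrue (true ∷ bs) = suc (countTrue bs)
    countTrue (false ∷ bs) = countTrue bs

    allB : List Bool → Bool
    allB [] = true
    allB (b ∷ bs) = b ∧ allB bs

    -- LocalImpCut at depth 3 (variable node) and depth 2 (clause node)
    local3 : ∀ {r} → VTree n e r → Bool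
    local3 v = low (varlabel v)

    local2 : ∀ {r} → CTree n e r → Bool
    local2 (cnode _ vs) = allB (map local3 vs)

    -- LocalImpCut at depth 1 ("at least d-2 of the d-1 children",
    -- d - 2 = e ∸ 1).  A depth-1 leaf (only possible if h = 1) has no
    -- children.
    Local1 : ∀ {r} → VTree n e r → Set
    Local1 (leaf y) = (π y ℚ.< p) ⊎ ((𝕀 y ≡ true) × (e ∸ 1 ≤ 0))
    Local1 (vnode y ws) =
      (π y ℚ.< p) ⊎ ((𝕀 y ≡ true) × (e ∸ 1 ≤ countTrue (map (local2 ∘ ws) (allFin e))))

    ImpCut : ∀ {r} → CTree n e r → Set
    ImpCut (cnode _ vs) = All (λ v → CutV v ⊎ Local1 v) vs

geomSum : ℕ → ℕ → ℕ
geomSum L zero = 1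
geomSum L (suc t) = geomSum L t + L ^ suc t

IsHTilde : ℕ → ℕ → ℕ → Set
IsHTilde L D h̃ = (geomSum L h̃ ≤ D) × (D < geomSum L (suc h̃))

-- Suppose c′ ∈ Plaus(x, F^{[V ↦ d]}). The clauses of T^h_{x,c′} restricted by [V ↦ d] are at
-- most 1 + L + … + L^h̃ ≤ D clauses of F^{[V ↦ d]}, so some β with β(x) = c′ satisfies all of
-- them. Walk down the tree from the root: at a clause node u (falsified by β_u) the restricted
-- clause is satisfied by β only through a literal (y ≠ d) with y ∉ V and β(y) ≠ d; descend to the
-- child of y with colour β(y). Every variable z with π(z) < π(x) lies in V, so the walk cannot
-- cross a cut. Otherwise the root's child y satisfies LocalImpCut impatiently: all its depth-2
-- children but at most one have only low children. If the child of colour β(y) is one of them the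
-- walk is cut there; if not, each other colour i has such a child, whose clause has k - 1
-- literals (w ≠ d) with w ∈ W′ by non-privilegedness, and so becomes the unit clause (y ≠ i)
-- under [W′ ↦ d] (it cannot become (x ≠ c′), which would then be D-implied). Hence
-- |Plaus(y, F^{[W′ ↦ d]})| ≤ 2 for the unassigned impatient y, and the while loop could not
-- have stopped at W′.

{-# OPTIONS --safe #-}
module Submission where

open import Defs
open import Data.Nat using (ℕ; _≤_; _*_; _∸_)
open import Data.Fin using (Fin; inject₁)
open import Data.Fin.Subset using (Subset)
open import Data.Bool using (Bool; true)
open import Data.Product using (_×_)
open import Relation.Binary.PropositionalEquality using (_≡_)
open import Function.Definitions using (Injective)
open import Data.Rational using (ℚ; 0ℚ; 1ℚ; _<_) renaming (_≤_ to _≤ℚ_)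

open import Data.Nat using (zero; suc; _+_; _^_; z≤n; s≤s)
import Data.Nat.Properties as ℕₚ
open import Data.Nat.ListAction using (sum)
import Data.Fin as Fin
import Data.Fin.Properties as Finₚ
open import Data.Fin.Subset using (_∈_; _∉_; _⊆_; _-_; ⁅_⁆)
import Data.Fin.Subset.Properties as Subsetₚ
import Data.Vec as Vec
import Data.Vec.Properties as Vecₚ
open import Data.Bool using (false)
import Data.Bool.Properties as Boolₚ
open import Data.Maybe using (Maybe; just; nothing)
import Data.Maybe.Properties as Maybeₚ
open import Data.List using (List; []; _∷_; _++_; length; map; concatMap; mapMaybe; allFin; filter)
import Data.List.Properties as Listₚ
open import Data.List.Relation.Unary.All as All using (All; []; _∷_)
import Data.List.Relation.Unary.All.Properties as Allₚ
open import Data.List.Relation.Unary.Any using (here; there)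
import Data.List.Membership.Propositional as Mem
open Mem using (find; lose)
import Data.List.Membership.Propositional.Properties as Memₚ
open import Data.Product using (∃; _,_; proj₁; proj₂)
open import Data.Sum as Sum using (_⊎_; inj₁; inj₂)
open import Data.Empty using (⊥; ⊥-elim)
open import Relation.Nullary using (¬_; Dec; proof; yes; no; ¬?)
open import Relation.Binary.PropositionalEquality
  using (_≢_; refl; sym; trans; cong; subst; subst₂; module ≡-Reasoning)
open import Function using (_∘_)
import Data.Rational.Properties as ℚₚ
open import Relation.Nullary.Reflects using (Reflects; invert)

module _ {A B : Set} where

  length-concatMap : (f : A → List B) (xs : List A) →
                     length (concatMap f xs) ≡ sum (map (length ∘ f) xs)
  length-concatMap f []       = refl
  length-concatMap f (a ∷ xs) =
    trans (Listₚ.length-++ (f a)) (cong (length (f a) +_) (length-concatMap f xs))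

  ∈-mapMaybe⁺ : (f : A → Maybe B) {xs : List A} {a : A} {b : B} →
                a Mem.∈ xs → f a ≡ just b → b Mem.∈ mapMaybe f xs
  ∈-mapMaybe⁺ f {a ∷ xs} (here refl) fa≡b with f a
  ∈-mapMaybe⁺ f {a ∷ xs} (here refl) refl | just _ = here refl
  ∈-mapMaybe⁺ f {a ∷ xs} (there a∈xs) fa≡b with f a
  ... | just _  = there (∈-mapMaybe⁺ f a∈xs fa≡b)
  ... | nothing = ∈-mapMaybe⁺ f a∈xs fa≡b

  All-mapMaybe⁻ : {P : B → Set} (f : A → Maybe B) {xs : List A} →
                  All P (mapMaybe f xs) → ∀ {a b} → a Mem.∈ xs → f a ≡ just b → P b
  All-mapMaybe⁻ f {a ∷ xs} ps (here refl) fa≡b with f a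
  All-mapMaybe⁻ f {a ∷ xs} (p ∷ _) (here refl) refl | just _ = p
  All-mapMaybe⁻ f {a ∷ xs} ps (there a∈xs) fa≡b with f a
  ... | just _  = All-mapMaybe⁻ f (All.tail ps) a∈xs fa≡b
  ... | nothing = All-mapMaybe⁻ f ps a∈xs fa≡b

module _ {A : Set} (f : A → ℕ) (B : ℕ) where

  sum-map-≤ : ∀ xs → (∀ {a} → a Mem.∈ xs → f a ≤ B) → sum (map f xs) ≤ length xs * B
  sum-map-≤ []       _    = z≤n
  sum-map-≤ (a ∷ xs) f≤B = ℕₚ.+-mono-≤ (f≤B (here refl)) (sum-map-≤ xs (f≤B ∘ there))

  sum-map-tight : ∀ xs → (∀ {a} → a Mem.∈ xs → f a ≤ B) →
                  length xs * B ≤ sum (map f xs) → ∀ {a} → a Mem.∈ xs → B ≤ f a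
  sum-map-tight (a ∷ xs) f≤B tight (here refl) =
    ℕₚ.+-cancelʳ-≤ (length xs * B) B (f a)
      (ℕₚ.≤-trans tight (ℕₚ.+-monoʳ-≤ (f a) (sum-map-≤ xs (f≤B ∘ there))))
  sum-map-tight (a ∷ xs) f≤B tight (there a∈xs) =
    sum-map-tight xs (f≤B ∘ there)
      (ℕₚ.+-cancelˡ-≤ B (length xs * B) (sum (map f xs))
        (ℕₚ.≤-trans tight (ℕₚ.+-monoˡ-≤ (sum (map f xs)) (f≤B (here refl)))))
      a∈xs

length-allFin : ∀ m → length (allFin m) ≡ m
length-allFin m = Listₚ.length-tabulate {n = m} (λ i → i)

length≤1⇒≡ : ∀ {A : Set} (xs : List A) → length xs ≤ 1 →
             ∀ {a b} → a Mem.∈ xs → b Mem.∈ xs → a ≡ b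
length≤1⇒≡ (_ ∷ [])     _         (here refl) (here refl) = refl
length≤1⇒≡ (_ ∷ _ ∷ _) (s≤s ())

m∸[m∸1]≤1 : ∀ m → m ∸ (m ∸ 1) ≤ 1
m∸[m∸1]≤1 zero          = z≤n
m∸[m∸1]≤1 (suc zero)    = s≤s z≤n
m∸[m∸1]≤1 (suc (suc m)) = m∸[m∸1]≤1 (suc m)

module _ {e : ℕ} where

  inject₁≢top : (i : Fin e) → inject₁ i ≢ top
  inject₁≢top i eq = Finₚ.fromℕ≢inject₁ (sym eq)

  ≢top⇒inject₁ : (a : Color e) → a ≢ top → ∃ λ i → inject₁ i ≡ a
  ≢top⇒inject₁ a a≢top = Fin.lower₁ a e≢a , Finₚ.inject₁-lower₁ a e≢a
    where
    e≢a : e ≢ Fin.toℕ a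
    e≢a eq = a≢top (Finₚ.toℕ-injective (trans (sym eq) (sym (Finₚ.toℕ-fromℕ e))))

module _ {n e : ℕ} where

  update-≡ : (β : Assignment n e) (y : Fin n) (c : Color e) → update β y c y ≡ c
  update-≡ β y c with y Fin.≟ y
  ... | yes _   = refl
  ... | no y≢y = ⊥-elim (y≢y refl)

  update-≢ : (β : Assignment n e) (y : Fin n) (c : Color e) {z : Fin n} →
             z ≢ y → update β y c z ≡ β z
  update-≢ β y c {z} z≢y with z Fin.≟ y
  ... | yes z≡y = ⊥-elim (z≢y z≡y)
  ... | no _    = refl

  falsified : (β : Assignment n e) {C : Clause n e} → ¬ SatClause β C →
              ∀ {z a} → (z , a) Mem.∈ C → β z ≡ a
  falsified β unsat {z} {a} za∈C with β z Fin.≟ a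
  ... | yes βz≡a = βz≡a
  ... | no βz≢a  = ⊥-elim (unsat (lose za∈C βz≢a))

  nonTop? : (l : Lit n e) → Dec (proj₂ l ≢ top)
  nonTop? l = ¬? (proj₂ l Fin.≟ top)

  nonTopLits : Clause n e → Clause n e
  nonTopLits = filter nonTop?

  length-topVars+nonTopLits : (C : Clause n e) →
                              length (topVars C) + length (nonTopLits C) ≡ length C
  length-topVars+nonTopLits []            = refl
  length-topVars+nonTopLits ((y , a) ∷ C) with a Fin.≟ top
  ... | yes _ = cong suc (length-topVars+nonTopLits C)
  ... | no _  = trans (ℕₚ.+-suc _ _) (cong suc (length-topVars+nonTopLits C))

  ∈-topVars⁺ : (C : Clause n e) {z : Fin n} → (z , top) Mem.∈ C → z Mem.∈ topVars C
  ∈-topVars⁺ ((y , a) ∷ C) za∈C with a Fin.≟ top | za∈C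
  ... | yes _    | here refl = here refl
  ... | yes _    | there z∈C = there (∈-topVars⁺ C z∈C)
  ... | no a≢top | here refl = ⊥-elim (a≢top refl)
  ... | no _     | there z∈C = ∈-topVars⁺ C z∈C


  restrictClause-survives :
    (α : PartialAssignment n e) (C : Clause n e) →
    (∀ {z a b} → (z , a) Mem.∈ C → α z ≡ just b → b ≡ a) →
    ∃ λ C′ → restrictClause α C ≡ just C′ ×
             (∀ {l} → l Mem.∈ C′ → l Mem.∈ C × α (proj₁ l) ≡ nothing)
  restrictClause-survives α []            _     = [] , refl , λ ()
  restrictClause-survives α ((y , a) ∷ C) unsat
    with α y in αy | restrictClause-survives α C (unsat ∘ there)
  ... | nothing | C′ , eq , sub rewrite eq = (y , a) ∷ C′ , refl , sub′
    where
    sub′ : ∀ {l} → l Mem.∈ (y , a) ∷ C′ → l Mem.∈ (y , a) ∷ C × α (proj₁ l) ≡ nothing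
    sub′ (here refl) = here refl , αy
    sub′ (there l∈) = there (proj₁ (sub l∈)) , proj₂ (sub l∈)
  ... | just b  | C′ , eq , sub with b Fin.≟ a
  ...   | yes _   = C′ , eq , λ l∈ → there (proj₁ (sub l∈)) , proj₂ (sub l∈)
  ...   | no b≢a = ⊥-elim (b≢a (unsat (here refl) αy))

  restrict-⊆ : (α : PartialAssignment n e) {F : Formula n e} (Cs : Formula n e) →
               All (Mem._∈ F) Cs → All (Mem._∈ restrict α F) (restrict α Cs)
  restrict-⊆ α []       []            = []
  restrict-⊆ α (C ∷ Cs) (C∈F ∷ Cs⊆F) with restrictClause α C in eq
  ... | just C′ = ∈-mapMaybe⁺ (restrictClause α) C∈F eq ∷ restrict-⊆ α Cs Cs⊆F
  ... | nothing = restrict-⊆ α Cs Cs⊆F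

  DImplies-unit : ∀ {D} → 1 ≤ D → (α : PartialAssignment n e) {F : Formula n e} {C : Clause n e} →
                  C Mem.∈ F → (l : Lit n e) → α (proj₁ l) ≡ nothing →
                  (∀ {z a} → (z , a) Mem.∈ C → (z , a) ≡ l ⊎ α z ≡ just a) →
                  DImplies D (restrict α F) l
  DImplies-unit D≥1 α {C = C} C∈F l free others
    with restrictClause-survives α C unsat
    where
    unsat : ∀ {z a b} → (z , a) Mem.∈ C → α z ≡ just b → b ≡ a
    unsat za∈C αz≡b with others za∈C
    ... | inj₁ refl with () ← trans (sym free) αz≡b
    ... | inj₂ αz≡a = Maybeₚ.just-injective (trans (sym αz≡b) αz≡a)
  ... | C′ , eq , sub = C′ ∷ [] , D≥1 , ∈-mapMaybe⁺ (restrictClause α) C∈F eq ∷ [] , forces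
    where
    forces : ∀ β → All (SatClause β) (C′ ∷ []) → SatLit β l
    forces β (sat ∷ []) with find sat
    ... | (z , a) , za∈C′ , βz≢a with sub za∈C′
    ...   | za∈C , αz≡nothing with others za∈C
    ...     | inj₁ refl = βz≢a
    ...     | inj₂ αz≡a with () ← trans (sym αz≡nothing) αz≡a

x∉p-x : ∀ {n} (p : Subset n) (x : Fin n) → x ∉ p - x
x∉p-x (_ Vec.∷ p) Fin.zero    ()
x∉p-x (_ Vec.∷ p) (Fin.suc x) (Vec.there x∈) = x∉p-x p x x∈

module _ {n e : ℕ} {U : Subset n} {z : Fin n} where

  fixTop-∈ : z ∈ U → fixTop {e = e} U z ≡ just top
  fixTop-∈ z∈U rewrite Vecₚ.[]=⇒lookup z∈U = refl

  fixTop-∉ : z ∉ U → fixTop {e = e} U z ≡ nothing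
  fixTop-∉ z∉U with Vec.lookup U z in Uz
  ... | true  = ⊥-elim (z∉U (Vecₚ.lookup⇒[]= z U Uz))
  ... | false = refl

  fixTop-just : ∀ {b} → fixTop {e = e} U z ≡ just b → z ∈ U × b ≡ top
  fixTop-just eq with Vec.lookup U z in Uz
  fixTop-just refl | true = Vecₚ.lookup⇒[]= z U Uz , refl

  fixTop-nothing : fixTop {e = e} U z ≡ nothing → z ∉ U
  fixTop-nothing eq z∈U with () ← trans (sym eq) (fixTop-∈ z∈U)

module _ {n e : ℕ} (D : ℕ) (F : Formula n e) (𝕀 : Fin n → Bool) where
  open Impatient D F 𝕀

  closure-⊆ : ∀ {U W} → Closure U W → U ⊆ W
  closure-⊆ (stop _)       z∈U = z∈U
  closure-⊆ (step y _ run) z∈U = closure-⊆ run (Subsetₚ.p⊆p∪q ⁅ y ⁆ z∈U)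

  closure-stuck : ∀ {U W} → Closure U W → ∀ y → ¬ Eligible W y
  closure-stuck (stop stuck)   = stuck
  closure-stuck (step _ _ run) = closure-stuck run

  process-⊆ : ∀ {U zs W} → Process U zs W → U ⊆ W
  process-⊆ done                      z∈U = z∈U
  process-⊆ (iter {z = z} close rest) z∈U =
    process-⊆ rest (Subsetₚ.p⊆p∪q ⁅ z ⁆ (closure-⊆ close z∈U))

  process-∈ : ∀ {U zs W} → Process U zs W → ∀ {z} → z Mem.∈ zs → z ∈ W
  process-∈ (iter {z = z} _ rest) (here refl) =
    process-⊆ rest (Subsetₚ.x∈p∪q⁺ (inj₂ (Subsetₚ.x∈⁅x⁆ z)))
  process-∈ (iter _ rest)         (there z∈zs) = process-∈ rest z∈zs

module _ {n e : ℕ} where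

  mutual
    clausesC : ∀ {r} → CTree n e r → List (Clause n e)
    clausesC (cnode C vs) = C ∷ clausesK vs

    clausesK : ∀ {r} → List (VTree n e r) → List (Clause n e)
    clausesK []       = []
    clausesK (v ∷ vs) = clausesV v ++ clausesK vs

    clausesV : ∀ {r} → VTree n e r → List (Clause n e)
    clausesV (leaf _)     = []
    clausesV (vnode _ ws) = concatMap (λ i → clausesC (ws i)) (allFin e)

  clausesK-leaves : (vs : List (VTree n e 0)) → clausesK vs ≡ []
  clausesK-leaves []            = refl
  clausesK-leaves (leaf _ ∷ vs) = clausesK-leaves vs

  ∈-clausesK⁺ : ∀ {r} {v : VTree n e r} {vs C} →
                v Mem.∈ vs → C Mem.∈ clausesV v → C Mem.∈ clausesK vs
  ∈-clausesK⁺ {vs = v ∷ _}  (here refl) C∈ = Memₚ.∈-++⁺ˡ C∈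
  ∈-clausesK⁺ {vs = w ∷ _}  (there v∈)  C∈ = Memₚ.∈-++⁺ʳ (clausesV w) (∈-clausesK⁺ v∈ C∈)

  ∈-clausesV⁺ : ∀ {r} y (ws : Fin e → CTree n e r) i {C} →
                C Mem.∈ clausesC (ws i) → C Mem.∈ clausesV (vnode y ws)
  ∈-clausesV⁺ y ws i C∈ =
    Memₚ.∈-concatMap⁺ (λ i → clausesC (ws i)) (lose (Memₚ.∈-allFin i) C∈)

  module _ {F : Formula n e} {r : ℕ} {β : Assignment n e} where

    length-ValidKids : ∀ {ys} {vs : List (VTree n e r)} → ValidKids F β ys vs →
                       length vs ≡ length ys
    length-ValidKids {[]}    {[]}    _         = refl
    length-ValidKids {_ ∷ _} {_ ∷ _} (_ , _ , ok) = cong suc (length-ValidKids ok)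

    ValidKids-∈ : ∀ {ys} {vs : List (VTree n e r)} → ValidKids F β ys vs →
                  ∀ {v} → v Mem.∈ vs → ValidV F β v
    ValidKids-∈ {_ ∷ _} {_ ∷ _} (_ , ok , _)  (here refl) = ok
    ValidKids-∈ {_ ∷ _} {_ ∷ _} (_ , _ , oks) (there v∈)  = ValidKids-∈ oks v∈

    ValidKids-child : ∀ {ys} {vs : List (VTree n e r)} → ValidKids F β ys vs →
                      ∀ {z} → z Mem.∈ ys → ∃ λ v → v Mem.∈ vs × varlabel v ≡ z × ValidV F β v
    ValidKids-child {_ ∷ _} {v ∷ _} (eq , ok , _) (here refl) = v , here refl , eq , ok
    ValidKids-child {_ ∷ _} {_ ∷ _} (_ , _ , oks) (there z∈)
      with v , v∈ , eq , ok ← ValidKids-child oks z∈ = v , there v∈ , eq , ok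

  module _ {F : Formula n e} where
    mutual
      clausesC-⊆ : ∀ {r β} (T : CTree n e r) → ValidC F β T → All (Mem._∈ F) (clausesC T)
      clausesC-⊆ (cnode C vs) (C∈F , _ , ok) = C∈F ∷ clausesK-⊆ vs ok

      clausesK-⊆ : ∀ {r β ys} (vs : List (VTree n e r)) → ValidKids F β ys vs →
                   All (Mem._∈ F) (clausesK vs)
      clausesK-⊆ {ys = []}    []       _            = []
      clausesK-⊆ {ys = _ ∷ _} (v ∷ vs) (_ , ok , oks) =
        Allₚ.++⁺ (clausesV-⊆ v ok) (clausesK-⊆ vs oks)

      clausesV-⊆ : ∀ {r β} (v : VTree n e r) → ValidV F β v → All (Mem._∈ F) (clausesV v)
      clausesV-⊆ (leaf _)     _  = []
      clausesV-⊆ (vnode _ ws) ok =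
        Allₚ.concat⁺ (Allₚ.map⁺ (Allₚ.tabulate⁺ λ i → clausesC-⊆ (ws i) (ok i)))

  depth3Count : ∀ {r} → VTree n e r → ℕ
  depth3Count (leaf _)     = 0
  depth3Count (vnode _ ws) = length (concatMap (λ i → map varlabel (kidsOf (ws i))) (allFin e))

  length-depth3Labels : ∀ {r} (C : Clause n e) (vs : List (VTree n e r)) →
                        length (depth3Labels (cnode C vs)) ≡ sum (map depth3Count vs)
  length-depth3Labels C []                = refl
  length-depth3Labels C (leaf _ ∷ vs)     = length-depth3Labels C vs
  length-depth3Labels C (vnode y ws ∷ vs) =
    trans (Listₚ.length-++ (concatMap (λ i → map varlabel (kidsOf (ws i))) (allFin e)))
          (cong (depth3Count (vnode y ws) +_) (length-depth3Labels C vs))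

geomSum-suc : ∀ L r → geomSum L (suc r) ≡ suc (L * geomSum L r)
geomSum-suc L zero    = refl
geomSum-suc L (suc r) = begin
  geomSum L (suc r) + L ^ suc (suc r)   ≡⟨ cong (_+ L ^ suc (suc r)) (geomSum-suc L r) ⟩
  suc (L * geomSum L r + L * L ^ suc r) ≡⟨ cong suc (ℕₚ.*-distribˡ-+ L (geomSum L r) (L ^ suc r)) ⟨
  suc (L * geomSum L (suc r))           ∎
  where open ≡-Reasoning

1≤geomSum : ∀ L r → 1 ≤ geomSum L r
1≤geomSum L zero    = s≤s z≤n
1≤geomSum L (suc r) = ℕₚ.≤-trans (1≤geomSum L r) (ℕₚ.m≤m+n _ _)

module Bounds {n e : ℕ} (k : ℕ) (F : Formula n e) (csp : IsCSP k F)
              (sat : SatFormula (λ _ → top) F) where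

  K : ℕ
  K = k ∸ 1

  nonTop-witness : ∀ {C} → C Mem.∈ F → ∃ λ l → l Mem.∈ nonTopLits C
  nonTop-witness {C} C∈F with (z , a) , za∈C , top≢a ← find (All.lookup sat C∈F) =
    (z , a) , Memₚ.∈-filter⁺ nonTop? za∈C (top≢a ∘ sym)

  length-topVars≤ : ∀ {C} → C Mem.∈ F → length (topVars C) ≤ K
  length-topVars≤ {C} C∈F with l , l∈ ← nonTop-witness C∈F =
    ℕₚ.m+n≤o⇒m≤o∸n (length (topVars C))
      (subst (length (topVars C) + 1 ≤_)
             (trans (length-topVars+nonTopLits C) (All.lookup csp C∈F))
             (ℕₚ.+-monoʳ-≤ (length (topVars C)) (nonEmpty (nonTopLits C) l∈)))
    where
    nonEmpty : ∀ {A : Set} (xs : List A) {a} → a Mem.∈ xs → 1 ≤ length xs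
    nonEmpty (_ ∷ _) _ = s≤s z≤n

  unique-nonTop : ∀ {C} → C Mem.∈ F → K ≤ length (topVars C) →
                  ∃ λ l → l Mem.∈ C × proj₂ l ≢ top ×
                          (∀ {z a} → (z , a) Mem.∈ C → (z , a) ≡ l ⊎ a ≡ top)
  unique-nonTop {C} C∈F K≤tops with l , l∈ ← nonTop-witness C∈F =
    l , l∈C , l≢top , is-l
    where
    l∈C×l≢top = Memₚ.∈-filter⁻ nonTop? {xs = C} l∈
    l∈C = proj₁ l∈C×l≢top
    l≢top = proj₂ l∈C×l≢top
    t = length (topVars C)
    m = length (nonTopLits C)
    m≤1 : m ≤ 1
    m≤1 = begin
      m             ≡⟨ ℕₚ.m+n∸m≡n t m ⟨
      t + m ∸ t     ≡⟨ cong (_∸ t) (trans (length-topVars+nonTopLits C) (All.lookup csp C∈F)) ⟩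
      k ∸ t         ≤⟨ ℕₚ.∸-monoʳ-≤ k K≤tops ⟩
      k ∸ K         ≤⟨ m∸[m∸1]≤1 k ⟩
      1             ∎
      where open ℕₚ.≤-Reasoning
    is-l : ∀ {z a} → (z , a) Mem.∈ C → (z , a) ≡ l ⊎ a ≡ top
    is-l {z} {a} za∈C with a Fin.≟ top
    ... | yes a≡top = inj₂ a≡top
    ... | no a≢top  = inj₁ (length≤1⇒≡ (nonTopLits C) m≤1 (Memₚ.∈-filter⁺ nonTop? za∈C a≢top) l∈)

  length-kids≤ : ∀ {r β} (T : CTree n e r) → ValidC F β T → length (kidsOf T) ≤ K
  length-kids≤ (cnode C vs) (C∈F , _ , ok) =
    subst (_≤ K) (sym (length-ValidKids ok)) (length-topVars≤ C∈F)

  mutual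
    length-clausesC≤ : ∀ {r β} (T : CTree n e r) → ValidC F β T →
                       length (clausesC T) ≤ geomSum (e * K) r
    length-clausesC≤ {zero}  (cnode C vs) _ rewrite clausesK-leaves vs = s≤s z≤n
    length-clausesC≤ {suc r} (cnode C vs) valid@(_ , _ , ok) = begin
      suc (length (clausesK vs))       ≤⟨ s≤s (length-clausesK≤ vs ok) ⟩
      suc (length vs * (e * G))        ≤⟨ s≤s (ℕₚ.*-monoˡ-≤ (e * G) (length-kids≤ _ valid)) ⟩
      suc (K * (e * G))                ≡⟨ cong suc (ℕₚ.*-assoc K e G) ⟨
      suc (K * e * G)                  ≡⟨ cong (λ L → suc (L * G)) (ℕₚ.*-comm K e) ⟩
      suc (e * K * G)                  ≡⟨ geomSum-suc (e * K) r ⟨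
      geomSum (e * K) (suc r)          ∎
      where open ℕₚ.≤-Reasoning
            G = geomSum (e * K) r

    length-clausesK≤ : ∀ {r β ys} (vs : List (VTree n e (suc r))) → ValidKids F β ys vs →
                       length (clausesK vs) ≤ length vs * (e * geomSum (e * K) r)
    length-clausesK≤ {ys = []}    []       _              = z≤n
    length-clausesK≤ {ys = _ ∷ _} (v ∷ vs) (_ , ok , oks) =
      subst (_≤ _) (sym (Listₚ.length-++ (clausesV v)))
        (ℕₚ.+-mono-≤ (length-clausesV≤ v ok) (length-clausesK≤ vs oks))

    length-clausesV≤ : ∀ {r β} (v : VTree n e (suc r)) → ValidV F β v →
                       length (clausesV v) ≤ e * geomSum (e * K) r
    length-clausesV≤ {r} (vnode y ws) ok = begin
      length (clausesV (vnode y ws))                         ≡⟨ length-concatMap _ (allFin e) ⟩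
      sum (map (λ i → length (clausesC (ws i))) (allFin e))  ≤⟨ sum-map-≤ _ G (allFin e) bound ⟩
      length (allFin e) * G                                  ≡⟨ cong (_* G) (length-allFin e) ⟩
      e * G                                                  ∎
      where
      open ℕₚ.≤-Reasoning
      G = geomSum (e * K) r
      bound : ∀ {i} → i Mem.∈ allFin e → length (clausesC (ws i)) ≤ G
      bound {i} _ = length-clausesC≤ (ws i) (ok i)

  colourKids≤ : ∀ {r β y} {ws : Fin e → CTree n e r} → ValidV F β (vnode y ws) →
                ∀ i → length (map varlabel (kidsOf (ws i))) ≤ K
  colourKids≤ {ws = ws} ok i =
    subst (_≤ K) (sym (Listₚ.length-map varlabel (kidsOf (ws i)))) (length-kids≤ (ws i) (ok i))

  depth3Count≤ : ∀ {r β} (v : VTree n e r) → ValidV F β v → depth3Count v ≤ e * K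
  depth3Count≤ (leaf _)     _  = z≤n
  depth3Count≤ (vnode y ws) ok = begin
    depth3Count (vnode y ws)                                            ≡⟨ length-concatMap _ (allFin e) ⟩
    sum (map (λ i → length (map varlabel (kidsOf (ws i)))) (allFin e))  ≤⟨ sum-map-≤ _ K (allFin e) bound ⟩
    length (allFin e) * K                                               ≡⟨ cong (_* K) (length-allFin e) ⟩
    e * K                                                               ∎
    where
    open ℕₚ.≤-Reasoning
    bound : ∀ {i} → i Mem.∈ allFin e → length (map varlabel (kidsOf (ws i))) ≤ K
    bound {i} _ = colourKids≤ ok i

  -- At most K depth-1 nodes with at most (d-1)·K grandchildren each: the non-privileged lower
  -- bound K·K·(d-1) forces equality everywhere.
  depth3Count-saturated : ∀ {r β} (T : CTree n e r) → ValidC F β T →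
                          K * K * e ≤ length (depth3Labels T) →
                          ∀ {v} → v Mem.∈ kidsOf T → e * K ≤ depth3Count v
  depth3Count-saturated (cnode C vs) valid@(_ , _ , ok) many =
    sum-map-tight depth3Count (e * K) vs (λ v∈ → depth3Count≤ _ (ValidKids-∈ ok v∈)) (begin
      length vs * (e * K)           ≤⟨ ℕₚ.*-monoˡ-≤ (e * K) (length-kids≤ (cnode C vs) valid) ⟩
      K * (e * K)                   ≡⟨ cong (K *_) (ℕₚ.*-comm e K) ⟩
      K * (K * e)                   ≡⟨ ℕₚ.*-assoc K K e ⟨
      K * K * e                     ≤⟨ many ⟩
      length (depth3Labels (cnode C vs)) ≡⟨ length-depth3Labels C vs ⟩
      sum (map depth3Count vs)      ∎)
    where open ℕₚ.≤-Reasoning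

  kids-saturated : ∀ {r β y} {ws : Fin e → CTree n e r} → ValidV F β (vnode y ws) →
                   e * K ≤ depth3Count (vnode y ws) → ∀ i → K ≤ length (kidsOf (ws i))
  kids-saturated {ws = ws} ok many i =
    subst (K ≤_) (Listₚ.length-map varlabel (kidsOf (ws i)))
      (sum-map-tight (λ i → length (map varlabel (kidsOf (ws i)))) K (allFin e)
        (λ {i} _ → colourKids≤ ok i)
        (subst₂ _≤_ (cong (_* K) (sym (length-allFin e)))
                    (length-concatMap (λ i → map varlabel (kidsOf (ws i))) (allFin e)) many)
        (Memₚ.∈-allFin i))

module ImpCutArgument
  {n e k : ℕ} (e≥1 : 1 ≤ e) (k≥2 : 2 ≤ k) (D : ℕ) (D≥1 : 1 ≤ D)
  (F : Formula n e) (csp : IsCSP k F) (sat : SatFormula (λ _ → top) F)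
  (π : Fin n → ℚ) (𝕀 : Fin n → Bool) (x : Fin n) (c′ : Fin e)
  (W′ : Subset n) (low⇒∈W′ : ∀ {z} → π z < π x → z ∈ W′)
  (W′-stuck : ∀ y → ¬ Impatient.Eligible D F 𝕀 W′ y)
  (V : Subset n) (V≡W′-x : V ≡ W′ - x)
  (x-plausible : Plaus D (restrict (fixTop V) F) x (inject₁ c′))
  (β : Assignment n e) (βx≡c : β x ≡ inject₁ c′) where

  open Bounds k F csp sat
  open Events {e = e} π 𝕀 (π x)

  β₀ : Assignment n e
  β₀ = update (λ _ → top) x (inject₁ c′)

  RestrictSat : Clause n e → Set
  RestrictSat C = ∀ {C′} → restrictClause (fixTop V) C ≡ just C′ → SatClause β C′

  SatOn : List (Clause n e) → Set
  SatOn Cs = ∀ {C} → C Mem.∈ Cs → RestrictSat C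

  x∉V : x ∉ V
  x∉V x∈V = x∉p-x W′ x (subst (x ∈_) V≡W′-x x∈V)

  low⇒∈V : ∀ {z} → π z < π x → z ∈ V
  low⇒∈V {z} lt = subst (z ∈_) (sym V≡W′-x)
    (Subsetₚ.x∈p∧x≢y⇒x∈p-y (low⇒∈W′ lt) λ { refl → ℚₚ.<-irrefl refl lt })

  -- The invariant relating β to the assignments β_u along the path β takes through the tree.
  Consistent : Assignment n e → Set
  Consistent βu = (∀ z → βu z ≢ top → β z ≡ βu z) × (∀ z → z ∈ V → βu z ≡ top)

  consistent-update : ∀ {βu} → Consistent βu → ∀ {z a} → z ∉ V → β z ≡ a →
                      Consistent (update βu z a)
  consistent-update {βu} (agree , topOnV) {z} {a} z∉V βz≡a = agree′ , topOnV′
    where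
    agree′ : ∀ w → update βu z a w ≢ top → β w ≡ update βu z a w
    agree′ w ≢top with w Fin.≟ z
    ... | yes refl = βz≡a
    ... | no _     = agree w ≢top
    topOnV′ : ∀ w → w ∈ V → update βu z a w ≡ top
    topOnV′ w w∈V with w Fin.≟ z
    ... | yes refl = ⊥-elim (z∉V w∈V)
    ... | no _     = topOnV w w∈V

  consistent-β₀ : Consistent β₀
  consistent-β₀ = consistent-update ((λ _ ≢top → ⊥-elim (≢top refl)) , (λ _ _ → refl)) x∉V βx≡c

  falsified-on-V : ∀ {C βu} → ¬ SatClause βu C → Consistent βu →
                   ∀ {z a b} → (z , a) Mem.∈ C → fixTop V z ≡ just b → b ≡ a
  falsified-on-V {βu = βu} unsat (_ , topOnV) {z} za∈C eq with z∈V , refl ← fixTop-just eq =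
    trans (sym (topOnV z z∈V)) (falsified βu unsat za∈C)

  escape : ∀ {C βu} → ¬ SatClause βu C → Consistent βu → RestrictSat C →
           ∃ λ z → z Mem.∈ topVars C × z ∉ V × β z ≢ top × βu z ≡ top
  escape {C} {βu} unsat cons@(agree , _) satC
    with C′ , eq , sub ← restrictClause-survives (fixTop V) C (falsified-on-V unsat cons)
    with (z , a) , za∈C′ , βz≢a ← find (satC eq)
    with za∈C , free ← sub za∈C′
    with a Fin.≟ top
  ... | yes refl = z , ∈-topVars⁺ C za∈C , fixTop-nothing free , βz≢a , falsified βu unsat za∈C
  ... | no a≢top with βuz≡a ← falsified βu unsat za∈C =
    ⊥-elim (βz≢a (trans (agree z (subst (_≢ top) (sym βuz≡a) a≢top)) βuz≡a))

  SatOn-kid : ∀ {r C} {vs : List (VTree n e r)} {v} →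
              SatOn (clausesC (cnode C vs)) → v Mem.∈ vs → SatOn (clausesV v)
  SatOn-kid sat v∈ C∈ = sat (there (∈-clausesK⁺ v∈ C∈))

  SatOn-colour : ∀ {r} y (ws : Fin e → CTree n e r) i →
                 SatOn (clausesV (vnode y ws)) → SatOn (clausesC (ws i))
  SatOn-colour y ws i sat C∈ = sat (∈-clausesV⁺ y ws i C∈)

  CutAll-∈ : ∀ {r} {vs : List (VTree n e r)} {v} → v Mem.∈ vs → CutAll vs → CutV v
  CutAll-∈ (here refl) (cut , _)  = cut
  CutAll-∈ (there v∈)  (_ , cuts) = CutAll-∈ v∈ cuts

  mutual
    CutC⇒⊥ : ∀ {r βu} (T : CTree n e r) → ValidC F βu T → Consistent βu → CutC T →
             SatOn (clausesC T) → ⊥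
    CutC⇒⊥ (cnode C vs) (_ , unsat , ok) cons cuts sat
      with z , z∈tops , z∉V , βz≢top , _ ← escape unsat cons (sat (here refl))
      with v , v∈ , refl , okᵥ ← ValidKids-child ok z∈tops =
      CutV⇒⊥ v okᵥ cons (CutAll-∈ v∈ cuts) z∉V βz≢top (SatOn-kid sat v∈)

    CutV⇒⊥ : ∀ {r βu} (v : VTree n e r) → ValidV F βu v → Consistent βu → CutV v →
             varlabel v ∉ V → β (varlabel v) ≢ top → SatOn (clausesV v) → ⊥
    CutV⇒⊥ (leaf _)     _  _    low        z∉V _      _   = z∉V (low⇒∈V low)
    CutV⇒⊥ (vnode _ _)  _  _    (inj₁ low) z∉V _      _   = z∉V (low⇒∈V low)
    CutV⇒⊥ (vnode z ws) ok cons (inj₂ cuts) z∉V βz≢top sat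
      with i , i≡βz ← ≢top⇒inject₁ (β z) βz≢top =
      CutC⇒⊥ (ws i) (ok i) (consistent-update cons z∉V (sym i≡βz)) (cuts i)
        (SatOn-colour z ws i sat)

  low⇒< : ∀ z → low z ≡ true → π z < π x
  low⇒< z lowz = invert (subst (Reflects (π z < π x)) lowz (proof (π z ℚₚ.<? π x)))

  local2-low : ∀ {r} (C : Clause n e) (vs : List (VTree n e r)) → local2 (cnode C vs) ≡ true →
               All (λ v → π (varlabel v) < π x) vs
  local2-low C []       _   = []
  local2-low C (v ∷ vs) all =
    low⇒< (varlabel v) (Boolₚ.∧-conicalˡ (local3 v) rest all) ∷
    local2-low C vs (Boolₚ.∧-conicalʳ (local3 v) rest all)
    where rest = allB (map local3 vs)

  local2⇒CutC : ∀ {r} (T : CTree n e r) → local2 T ≡ true → CutC T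
  local2⇒CutC (cnode C vs) all = cutAll (local2-low C vs all)
    where
    cutAll : ∀ {vs} → All (λ v → π (varlabel v) < π x) vs → CutAll vs
    cutAll []                 = _
    cutAll {leaf _ ∷ _}    (low ∷ lows) = low , cutAll lows
    cutAll {vnode _ _ ∷ _} (low ∷ lows) = inj₁ low , cutAll lows

  local2-tops-low : ∀ {r βu C} {vs : List (VTree n e r)} → ValidKids F βu (topVars C) vs →
                    local2 (cnode C vs) ≡ true → ∀ {w} → (w , top) Mem.∈ C → π w < π x
  local2-tops-low {C = C} {vs} ok all w∈C
    with v , v∈ , refl , _ ← ValidKids-child ok (∈-topVars⁺ C w∈C) =
    All.lookup (local2-low C vs all) v∈

  low-unit : ∀ {C} → C Mem.∈ F → (∀ {w} → (w , top) Mem.∈ C → π w < π x) →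
             ∀ {z a} → (∀ {w b} → (w , b) Mem.∈ C → (w , b) ≡ (z , a) ⊎ b ≡ top) →
             ∀ U → (∀ {w} → π w < π x → w ∈ U) → z ∉ U → DImplies D (restrict (fixTop U) F) (z , a)
  low-unit C∈F tops-low only U low⇒∈U z∉U =
    DImplies-unit D≥1 (fixTop U) C∈F _ (fixTop-∉ z∉U) λ wb∈C → Sum.map₂ (fixed wb∈C) (only wb∈C)
    where
    fixed : ∀ {w b} → (w , b) Mem.∈ _ → b ≡ top → fixTop U w ≡ just b
    fixed wb∈C refl = fixTop-∈ (low⇒∈U (tops-low wb∈C))

  -- With its K literals (w ≠ d) all low, the clause has one further literal, falsified by
  -- β₀[y ↦ i]: it is (y ≠ i), or else (x ≠ c′), which F^{[V ↦ d]} would then D-imply.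
  forced-colour : ∀ {r} y (i : Fin e) (T : CTree n e r) → ValidC F (update β₀ y (inject₁ i)) T →
                  local2 T ≡ true → K ≤ length (kidsOf T) → y ∉ W′ →
                  DImplies D (restrict (fixTop W′) F) (y , inject₁ i)
  forced-colour y i (cnode C vs) (C∈F , unsat , ok) all saturated y∉W′
    with (z , a) , za∈C , a≢top , only ←
           unique-nonTop C∈F (subst (K ≤_) (length-ValidKids ok) saturated)
    with falsified _ unsat za∈C | z Fin.≟ y | z Fin.≟ x
  ... | βᵤz≡a | yes refl | _ =
    subst (λ b → DImplies D (restrict (fixTop W′) F) (y , b)) (trans (sym βᵤz≡a) (update-≡ β₀ y _))
      (low-unit C∈F (local2-tops-low ok all) only W′ low⇒∈W′ y∉W′)
  ... | βᵤz≡a | no z≢y | yes refl =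
    ⊥-elim (x-plausible (subst (λ b → DImplies D (restrict (fixTop V) F) (x , b))
      (trans (sym βᵤz≡a) (trans (update-≢ β₀ y _ z≢y) (update-≡ _ x _)))
      (low-unit C∈F (local2-tops-low ok all) only V low⇒∈V x∉V)))
  ... | βᵤz≡a | no z≢y | no z≢x =
    ⊥-elim (a≢top (trans (sym βᵤz≡a) (trans (update-≢ β₀ y _ z≢y) (update-≢ _ x _ z≢x))))

  countTrue-map≤ : ∀ {A : Set} (f : A → Bool) xs → countTrue (map f xs) ≤ length xs
  countTrue-map≤ f []       = z≤n
  countTrue-map≤ f (a ∷ xs) with f a
  ... | true  = s≤s (countTrue-map≤ f xs)
  ... | false = ℕₚ.m≤n⇒m≤1+n (countTrue-map≤ f xs)

  countTrue-map-false : ∀ {A : Set} (f : A → Bool) xs {a} → a Mem.∈ xs → f a ≡ false →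
                        suc (countTrue (map f xs)) ≤ length xs
  countTrue-map-false f (a ∷ xs) (here refl) fa with f a | fa
  ... | false | refl = s≤s (countTrue-map≤ f xs)
  countTrue-map-false f (b ∷ xs) (there a∈) fa with f b
  ... | true  = s≤s (countTrue-map-false f xs a∈ fa)
  ... | false = ℕₚ.m≤n⇒m≤1+n (countTrue-map-false f xs a∈ fa)

  countTrue-map-false₂ : ∀ {A : Set} (f : A → Bool) xs {a b} → a ≢ b → a Mem.∈ xs → b Mem.∈ xs →
                         f a ≡ false → f b ≡ false → 2 + countTrue (map f xs) ≤ length xs
  countTrue-map-false₂ f (c ∷ xs) a≢b (here refl) (here refl) _ _ = ⊥-elim (a≢b refl)
  countTrue-map-false₂ f (c ∷ xs) _ (here refl) (there b∈) fa fb with f c | fa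
  ... | false | refl = s≤s (countTrue-map-false f xs b∈ fb)
  countTrue-map-false₂ f (c ∷ xs) _ (there a∈) (here refl) fa fb with f c | fb
  ... | false | refl = s≤s (countTrue-map-false f xs a∈ fa)
  countTrue-map-false₂ f (c ∷ xs) a≢b (there a∈) (there b∈) fa fb with f c
  ... | true  = s≤s (countTrue-map-false₂ f xs a≢b a∈ b∈ fa fb)
  ... | false = ℕₚ.m≤n⇒m≤1+n (countTrue-map-false₂ f xs a≢b a∈ b∈ fa fb)

  all-but-one-true : (f : Fin e → Bool) → e ∸ 1 ≤ countTrue (map f (allFin e)) →
                     ∀ {i} → f i ≡ false → ∀ j → j ≢ i → f j ≡ true
  all-but-one-true f most {i} fi j j≢i with f j Boolₚ.≟ true
  ... | yes fj = fj
  ... | no ¬fj = ⊥-elim (¬2+[m∸1]≤m e (begin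
    2 + (e ∸ 1)                       ≤⟨ s≤s (s≤s most) ⟩
    2 + countTrue (map f (allFin e))  ≤⟨ countTrue-map-false₂ f (allFin e) j≢i (Memₚ.∈-allFin j)
                                            (Memₚ.∈-allFin i) (Boolₚ.¬-not ¬fj) fi ⟩
    length (allFin e)                 ≡⟨ length-allFin e ⟩
    e                                 ∎))
    where
    open ℕₚ.≤-Reasoning
    ¬2+[m∸1]≤m : ∀ m → ¬ 2 + (m ∸ 1) ≤ m
    ¬2+[m∸1]≤m zero    ()
    ¬2+[m∸1]≤m (suc m) (s≤s le) = ℕₚ.1+n≰n le

  plausible-colours : ∀ {r} y (ws : Fin e → CTree n e r) → ValidV F β₀ (vnode y ws) →
                      (∀ i → K ≤ length (kidsOf (ws i))) → y ∉ W′ →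
                      ∀ i → (∀ j → j ≢ i → local2 (ws j) ≡ true) →
                      ∀ a → Plaus D (restrict (fixTop W′) F) y a → a Mem.∈ top ∷ inject₁ i ∷ []
  plausible-colours y ws ok saturated y∉W′ i low a plausible = colour a plausible
    where
    forced : ∀ j → j ≢ i → DImplies D (restrict (fixTop W′) F) (y , inject₁ j)
    forced j j≢i = forced-colour y j (ws j) (ok j) (low j j≢i) (saturated j) y∉W′

    colour : ∀ a → Plaus D (restrict (fixTop W′) F) y a → a Mem.∈ top ∷ inject₁ i ∷ []
    colour a plausible with a Fin.≟ top
    ... | yes a≡top = here a≡top
    ... | no a≢top with j , refl ← ≢top⇒inject₁ a a≢top with j Fin.≟ i
    ...   | yes refl = there (here refl)
    ...   | no j≢i   = ⊥-elim (plausible (forced j j≢i))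

  impatient⇒⊥ : ∀ {r} y (ws : Fin e → CTree n e r) → ValidV F β₀ (vnode y ws) →
                (∀ i → K ≤ length (kidsOf (ws i))) → 𝕀 y ≡ true →
                e ∸ 1 ≤ countTrue (map (local2 ∘ ws) (allFin e)) →
                y ∉ V → y ≢ x → (∃ λ i → inject₁ i ≡ β y) → SatOn (clausesV (vnode y ws)) → ⊥
  impatient⇒⊥ y ws ok saturated 𝕀y most y∉V y≢x (i , i≡βy) sat
    with local2 (ws i) Boolₚ.≟ true | y Subsetₚ.∈? W′
  ... | yes lowᵢ   | _        =
    CutC⇒⊥ (ws i) (ok i) (consistent-update consistent-β₀ y∉V (sym i≡βy))
      (local2⇒CutC (ws i) lowᵢ) (SatOn-colour y ws i sat)
  ... | no _       | yes y∈W′ = y∉V (subst (y ∈_) (sym V≡W′-x) (Subsetₚ.x∈p∧x≢y⇒x∈p-y y∈W′ y≢x))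
  ... | no notLowᵢ | no y∉W′  = W′-stuck y (y∉W′ , 𝕀y , top ∷ inject₁ i ∷ [] , s≤s (s≤s z≤n) ,
    plausible-colours y ws ok saturated y∉W′ i
      (all-but-one-true (local2 ∘ ws) most (Boolₚ.¬-not notLowᵢ)))

  Local1⇒⊥ : ∀ {r} (v : VTree n e r) → ValidV F β₀ v → e * K ≤ depth3Count v → Local1 v →
             varlabel v ∉ V → varlabel v ≢ x → β (varlabel v) ≢ top → SatOn (clausesV v) → ⊥
  Local1⇒⊥ (leaf _) _ many _ _ _ _ _
    with () ← ℕₚ.≤-trans (ℕₚ.*-mono-≤ e≥1 (ℕₚ.∸-monoˡ-≤ 1 k≥2)) many
  Local1⇒⊥ (vnode y ws) _ _ (inj₁ low) y∉V _ _ _ = y∉V (low⇒∈V low)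
  Local1⇒⊥ (vnode y ws) ok many (inj₂ (𝕀y , most)) y∉V y≢x βy≢top =
    impatient⇒⊥ y ws ok (kids-saturated ok many) 𝕀y most y∉V y≢x (≢top⇒inject₁ (β y) βy≢top)

  ImpCut⇒⊥ : ∀ {r} (T : CTree n e r) → ValidC F β₀ T → K * K * e ≤ length (depth3Labels T) →
             ImpCut T → SatOn (clausesC T) → ⊥
  ImpCut⇒⊥ T@(cnode C vs) valid@(_ , unsat , ok) many impCut sat
    with y , y∈tops , y∉V , βy≢top , β₀y≡top ← escape unsat consistent-β₀ (sat (here refl))
    with v , v∈ , refl , okᵥ ← ValidKids-child ok y∈tops
    with All.lookup impCut v∈
  ... | inj₁ cut   = CutV⇒⊥ v okᵥ consistent-β₀ cut y∉V βy≢top (SatOn-kid sat v∈)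
  ... | inj₂ local = Local1⇒⊥ v okᵥ (depth3Count-saturated T valid many v∈) local y∉V y≢x βy≢top
                       (SatOn-kid sat v∈)
    where
    y≢x : varlabel v ≢ x
    y≢x refl = inject₁≢top c′ (trans (sym (update-≡ _ x _)) β₀y≡top)

lemma7 : (n e k : ℕ) → 1 ≤ e → 2 ≤ k →
    (θ : ℚ) → 0ℚ < θ → θ < 1ℚ →
    (D : ℕ) → (F : Formula n e) → IsCSP k F →
    SatFormula (λ _ → top) F →
    (∀ (β : Assignment n e) → SatFormula β F → ∀ y → β y ≡ top) →
    (π : Fin n → ℚ) → Injective _≡_ _≡_ π → (∀ y → (0ℚ ≤ℚ π y) × (π y ≤ℚ 1ℚ)) →
    (𝕀 : Fin n → Bool) → (∀ y → 𝕀 y ≡ true → π y < θ) →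
    (h̃ : ℕ) → IsHTilde (e * (k ∸ 1)) D h̃ →
    (x : Fin n) → (T : Fin e → CTree n e h̃) →
    (∀ c″ → IsCCTree F h̃ x c″ (T c″)) → NonPrivileged k T →
    (c′ : Fin e) →
    Events.ImpCut π 𝕀 (π x) (T c′) →
    (V : Subset n) → IsVimp D F π 𝕀 x V →
    AimpZero D F V x (inject₁ c′)
lemma7 n e k e≥1 k≥2 _ _ _ D F csp sat _ π _ _ 𝕀 _ h̃ (geomSum≤D , _) x T valid nonPrivileged c′
       impCut V (_ , _ , W′ , (_ , before) , process , closure , V≡W′-x) x-plausible =
  x-plausible
    (restrict α Cs , length-restrict≤D , restrict-⊆ α Cs (clausesC-⊆ (T c′) (valid c′)) , forces)
  where
  open Bounds k F csp sat using (length-clausesC≤)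
  α  = fixTop V
  Cs = clausesC (T c′)

  length-restrict≤D : length (restrict α Cs) ≤ D
  length-restrict≤D = ℕₚ.≤-trans (Listₚ.length-mapMaybe (restrictClause α) Cs)
                        (ℕₚ.≤-trans (length-clausesC≤ (T c′) (valid c′)) geomSum≤D)

  forces : ∀ β → All (SatClause β) (restrict α Cs) → β x ≢ inject₁ c′
  forces β satRestricted βx≡c =
    ImpCut⇒⊥ (T c′) (valid c′) (proj₁ (nonPrivileged c′)) impCut
      (λ C∈ → All-mapMaybe⁻ (restrictClause α) satRestricted C∈)
    where
    open ImpCutArgument e≥1 k≥2 D (ℕₚ.≤-trans (1≤geomSum _ h̃) geomSum≤D) F csp sat π 𝕀 x c′ W′
           (λ lt → closure-⊆ D F 𝕀 closure (process-∈ D F 𝕀 process (proj₂ (before _) lt)))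
           (closure-stuck D F 𝕀 closure) V V≡W′-x x-plausible β βx≡c
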